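{- Let $\mathrm{S}=(P,T,F,M_0)$ be a place/transition net. For every $a\in T$ there exists $\mathrm{k}_a\in\mathbb{N}$ such that for every marking $M\in\mathbb{N}^P$, the transition $a$ is $\mathrm{k}_a$-enabled in $M$ or $a$ is dead in $M$.
   Context: A place/transition net (p/t-net) is $\mathrm{S}=(P,T,F,M_0)$ where $P$ (places) and $T$ (transitions) are finite disjoint sets, $F\subseteq P\times T\cup T\times P$ is the flow relation, and $M_0\in\mathbb{N}^P$ is the initial marking. Markings are vectors in $\mathbb{N}^P$, ordered and added componentwise. For $a\in T$, ${}^\bullet a\in\mathbb{N}^P$ is the vector with $1$ at places $p$ with $(p,a)\in F$ and $0$ elsewhere; $a^\bullet$ is the vector with $1$ at places $p$ with $(a,p)\in F$ and $0$ elsewhere. A transition $a$ is enabled in $M$ (written $Ma$) iff ${}^\bullet a\le M$; then firing $a$ yields $M'=(M-{}^\bullet a)+a^\bullet$ (written $MaM'$). This is extended to strings $w\in T^*$: $M\varepsilon M$, and $MvaM''$ iff $MvM'$ and $M'aM''$ for some $M'$; $Mw$ means $MwM'$ for some $M'$. A transition $a$ is live in $M$ iff there is $u\in T^*$ with $Mua$, and dead in $M$ otherwise. For $\mathrm{k}\in\mathbb{N}$, $a$ is $\mathrm{k}$-enabled in $M$ iff there exists $w\in T^*$ with $|w|\le\mathrm{k}$ and $Mwa$. -}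

module Defs where

open import Data.Nat using (ℕ; _≤_; _+_; _∸_)
open import Data.Bool using (Bool; true; false)
open import Data.Fin using (Fin)
open import Data.List using (List; []; _∷_; length)
open import Data.Product using (Σ; ∃; _×_; _,_)
open import Relation.Nullary using (¬_)
open import Data.Unit using (⊤)

-- A place/transition net S = (P, T, F, M₀) with finite P = Fin np, T = Fin nt.
-- The flow relation F ⊆ P×T ∪ T×P is given by its two characteristic functions.
record PTNet : Set where
  field
    np nt : ℕ
    Fpt   : Fin np → Fin nt → Bool
    Ftp   : Fin nt → Fin np → Bool
    M₀    : Fin np → ℕ

module _ (S : PTNet) where
  open PTNet S

  Place : Set
  Place = Fin np

  Trans : Set
  Trans = Fin nt

  Marking : Set
  Marking = Place → ℕ

  χ : Bool → ℕ
  χ true  = 1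
  χ false = 0

  pre : Trans → Marking
  pre a p = χ (Fpt p a)

  post : Trans → Marking
  post a p = χ (Ftp a p)

  _≤ᴹ_ : Marking → Marking → Set
  M ≤ᴹ M' = ∀ p → M p ≤ M' p

  Enabled : Marking → Trans → Set
  Enabled M a = pre a ≤ᴹ M

  -- the marking (M − •a) + a• reached by firing a (truncated subtraction is
  -- exact whenever a is enabled, which is the only case it is used)
  fire : Marking → Trans → Marking
  fire M a p = (M p ∸ pre a p) + post a p

  Firable : Marking → List Trans → Set
  Firable M []      = ⊤
  Firable M (a ∷ w) = Enabled M a × Firable (fire M a) w

  -- final marking after firing w from M (meaningful when Firable M w)
  after : Marking → List Trans → Marking
  after M []      = M
  after M (a ∷ w) = after (fire M a) w

  FirableThen : Marking → List Trans → Trans → Set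
  FirableThen M w a = Firable M w × Enabled (after M w) a

  Live : Marking → Trans → Set
  Live M a = ∃ λ (u : List Trans) → FirableThen M u a

  Dead : Marking → Trans → Set
  Dead M a = ¬ Live M a

  KEnabled : ℕ → Marking → Trans → Set
  KEnabled k M a = ∃ λ (w : List Trans) → length w ≤ k × FirableThen M w a

-- Rackoff's argument. Call w a witness on a list I of places (FirableThenOn I M w a)
-- if w followed by a can fire when only the preconditions at places of I are checked.
-- By induction on |I|, every witness on I shortens to one of length at most K_|I|:
-- follow it until some place p of I first holds more than K_(|I|-1) tokens. Before
-- that point the markings restricted to I lie in a finite box, so cycles can be cut
-- out of the prefix; after it, a short witness on I without p, given by induction, is
-- also a witness on I, because each firing removes at most one token from p. For I = P
-- this bounds the shortest witness of liveness, and since k-enabledness is decidable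
-- by enumeration, "k-enabled or dead" holds constructively.
module Submission where

open import Defs
open import Data.Nat using (ℕ; zero; suc; _+_; _∸_; _≤_; _<_; z≤n; s≤s; _≤?_)
import Data.Nat as ℕ
open import Data.Nat.Properties
  using (≤-refl; ≤-trans; ≤-reflexive; ≤-pred; ≰⇒>; m≤m+n; m≤n+m∸n; +-monoˡ-≤; +-mono-≤; module ≤-Reasoning)
open import Data.Bool using (true; false)
open import Data.Fin.Properties using (all?)
open import Data.List using (List; []; _∷_; [_]; length; map; _++_; filter; upTo; allFin; concatMap)
open import Data.List.Properties using (length-map; length-++; length-removeAt′; length-tabulate; filter-notAll; ≡-dec; ∷-injective)
open import Data.List.Relation.Unary.All as All using (All; []; _∷_)
open import Data.List.Relation.Unary.All.Properties using (─⁺; ─⁻; ¬Any⇒All¬; map⁺)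
open import Data.List.Relation.Unary.Any as Any using (Any; here; there; _─_)
open import Data.List.Relation.Unary.Any.Properties using (lookup-result)
open import Data.List.Relation.Unary.Unique.Propositional using (Unique; []; _∷_)
open import Data.List.Relation.Binary.Subset.Propositional using (_⊆_)
open import Data.List.Membership.Propositional using (_∈_)
open import Data.List.Membership.Propositional.Properties using (∈-allFin; ∈-upTo⁺; ∈-concatMap⁺; ∈-map⁺; ∈-filter⁺)
open import Data.Product using (∃; ∃₂; _×_; _,_; proj₁; proj₂)
open import Data.Sum using (_⊎_; inj₁; inj₂)
open import Data.Unit using (⊤; tt)
open import Function using (_∘_)
open import Relation.Nullary using (¬_; Dec; yes; no; ¬?)
open import Relation.Nullary.Decidable using (_×-dec_)
open import Relation.Binary.Definitions using (DecidableEquality)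
open import Relation.Binary.PropositionalEquality using (_≡_; refl; sym; cong; cong₂; subst)

listsUpTo : {A : Set} → List A → ℕ → List (List A)
listsUpTo xs zero    = [ [] ]
listsUpTo xs (suc m) = [] ∷ concatMap (λ x → map (x ∷_) (listsUpTo xs m)) xs

∈-listsUpTo : {A : Set} (xs : List A) (m : ℕ) {ys : List A} →
              All (_∈ xs) ys → length ys ≤ m → ys ∈ listsUpTo xs m
∈-listsUpTo xs zero    []             _            = here refl
∈-listsUpTo xs zero    (_ ∷ _)        ()
∈-listsUpTo xs (suc m) []             _            = here refl
∈-listsUpTo xs (suc m) (y∈xs ∷ ys⊆xs) (s≤s |ys|≤m) =
  there (∈-concatMap⁺ (λ x → map (x ∷_) (listsUpTo xs m))
          (Any.map (λ { refl → ∈-map⁺ (_ ∷_) (∈-listsUpTo xs m ys⊆xs |ys|≤m) }) y∈xs))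

module _ {A : Set} (_≟_ : DecidableEquality A) where

  Unique-⊆⇒length≤ : {xs ys : List A} → Unique xs → xs ⊆ ys → length xs ≤ length ys
  Unique-⊆⇒length≤ {[]}         _            _     = z≤n
  Unique-⊆⇒length≤ {x ∷ xs} {ys} (x∉xs ∷ xs!) xs⊆ys =
    ≤-trans (s≤s (Unique-⊆⇒length≤ xs! xs⊆ys∖x))
            (filter-notAll x≢? ys (Any.map (λ x≡y x≢y → x≢y x≡y) (xs⊆ys (here refl))))
    where
      x≢? : (y : A) → Dec (¬ x ≡ y)
      x≢? y = ¬? (x ≟ y)
      xs⊆ys∖x : xs ⊆ filter x≢? ys
      xs⊆ys∖x z∈xs = ∈-filter⁺ x≢? (xs⊆ys (there z∈xs)) (All.lookup x∉xs z∈xs)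

module _ (S : PTNet) where
  open PTNet S using (np; nt; Fpt)

  Run : (Marking S → Trans S → Set) → Marking S → List (Trans S) → Set
  Run R M []      = ⊤
  Run R M (b ∷ w) = R M b × Run R (fire S M b) w

  Run-map : {R R′ : Marking S → Trans S → Set} → (∀ {M b} → R M b → R′ M b) →
            ∀ {M} w → Run R M w → Run R′ M w
  Run-map f []      _        = tt
  Run-map f (b ∷ w) (r , rs) = f r , Run-map f w rs

  after-++ : ∀ M u v → after S M (u ++ v) ≡ after S (after S M u) v
  after-++ M []      v = refl
  after-++ M (b ∷ u) v = after-++ (fire S M b) u v

  Run-++ : {R : Marking S → Trans S → Set} → ∀ M u {v} →
           Run R M u → Run R (after S M u) v → Run R M (u ++ v)
  Run-++ M []      _        rs′ = rs′
  Run-++ M (b ∷ u) (r , rs) rs′ = r , Run-++ (fire S M b) u rs rs′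

  firstHit : {R : Marking S → Trans S → Set} {P : Marking S → Set} →
             (∀ M → Dec (P M)) → ∀ M w → Run R M w →
             Run (λ M′ b → R M′ b × ¬ P M′) M w
             ⊎ ∃₂ λ u v → w ≡ u ++ v × Run (λ M′ b → R M′ b × ¬ P M′) M u
                           × P (after S M u) × Run R (after S M u) v
  firstHit P? M w rs with P? M
  ... | yes hit = inj₂ ([] , w , refl , tt , hit , rs)
  firstHit P? M []      _        | no miss = inj₁ tt
  firstHit P? M (b ∷ w) (r , rs) | no miss with firstHit P? (fire S M b) w rs
  ... | inj₁ rs′                              = inj₁ ((r , miss) , rs′)
  ... | inj₂ (u , v , refl , rsᵤ , hit , rsᵥ) = inj₂ (b ∷ u , v , refl , ((r , miss) , rsᵤ) , hit , rsᵥ)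

  EnabledOn : List (Place S) → Marking S → Trans S → Set
  EnabledOn I M b = All (λ p → pre S b p ≤ M p) I

  FirableThenOn : List (Place S) → Marking S → List (Trans S) → Trans S → Set
  FirableThenOn I M w a = Run (EnabledOn I) M w × EnabledOn I (after S M w) a

  FirableThenOn-++ : ∀ {I a} M u {v} → Run (EnabledOn I) M u →
                     FirableThenOn I (after S M u) v a → FirableThenOn I M (u ++ v) a
  FirableThenOn-++ {I} {a} M u {v} rsᵤ (rsᵥ , en) =
    Run-++ M u rsᵤ rsᵥ , subst (λ M′ → EnabledOn I M′ a) (sym (after-++ M u v)) en

  AgreeOn : List (Place S) → Marking S → Marking S → Set
  AgreeOn I M M′ = All (λ p → M p ≡ M′ p) I

  AgreeOn-subst : ∀ {I M M′} (Q : Place S → ℕ → Set) → AgreeOn I M M′ →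
                  All (λ p → Q p (M p)) I → All (λ p → Q p (M′ p)) I
  AgreeOn-subst Q []       []       = []
  AgreeOn-subst Q (e ∷ es) (q ∷ qs) = subst (Q _) e q ∷ AgreeOn-subst Q es qs

  AgreeOn-refl : ∀ I M → AgreeOn I M M
  AgreeOn-refl I M = All.tabulate (λ _ → refl)

  AgreeOn-sym : ∀ {I M M′} → AgreeOn I M M′ → AgreeOn I M′ M
  AgreeOn-sym = All.map sym

  AgreeOn-trans : ∀ {I M M′ M″} → AgreeOn I M M′ → AgreeOn I M′ M″ → AgreeOn I M M″
  AgreeOn-trans {M = M} e e′ = AgreeOn-subst (λ p n → M p ≡ n) e′ e

  fire-AgreeOn : ∀ {I M M′} b → AgreeOn I M M′ → AgreeOn I (fire S M b) (fire S M′ b)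
  fire-AgreeOn b = All.map (λ {p} → cong (λ n → n ∸ pre S b p + post S b p))

  after-AgreeOn : ∀ {I M M′} w → AgreeOn I M M′ → AgreeOn I (after S M w) (after S M′ w)
  after-AgreeOn []      e = e
  after-AgreeOn (b ∷ w) e = after-AgreeOn w (fire-AgreeOn b e)

  RespectsAgreeOn : List (Place S) → (Marking S → Trans S → Set) → Set
  RespectsAgreeOn I R = ∀ {M M′ b} → AgreeOn I M M′ → R M b → R M′ b

  EnabledOn-respects : ∀ {I} → RespectsAgreeOn I (EnabledOn I)
  EnabledOn-respects {b = b} = AgreeOn-subst (λ p n → pre S b p ≤ n)

  Run-AgreeOn : ∀ {I R} → RespectsAgreeOn I R → ∀ {M M′} w → AgreeOn I M M′ → Run R M w → Run R M′ w
  Run-AgreeOn resp []      e _        = tt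
  Run-AgreeOn resp (b ∷ w) e (r , rs) = resp e r , Run-AgreeOn resp w (fire-AgreeOn b e) rs

  FirableThenOn-AgreeOn : ∀ {I M M′ a} w → AgreeOn I M M′ → FirableThenOn I M w a → FirableThenOn I M′ w a
  FirableThenOn-AgreeOn w e (rs , en) =
    Run-AgreeOn EnabledOn-respects w e rs , EnabledOn-respects (after-AgreeOn w e) en

  projection : List (Place S) → Marking S → List ℕ
  projection I M = map M I

  AgreeOn⇒projection≡ : ∀ {I M M′} → AgreeOn I M M′ → projection I M ≡ projection I M′
  AgreeOn⇒projection≡ []       = refl
  AgreeOn⇒projection≡ (e ∷ es) = cong₂ _∷_ e (AgreeOn⇒projection≡ es)

  projection≡⇒AgreeOn : ∀ I {M M′} → projection I M ≡ projection I M′ → AgreeOn I M M′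
  projection≡⇒AgreeOn []      _  = []
  projection≡⇒AgreeOn (p ∷ I) eq = let e , es = ∷-injective eq in e ∷ projection≡⇒AgreeOn I es

  visits : List (Place S) → Marking S → List (Trans S) → List (List ℕ)
  visits I M []      = []
  visits I M (b ∷ w) = projection I M ∷ visits I (fire S M b) w

  length-visits : ∀ I M w → length (visits I M w) ≡ length w
  length-visits I M []      = refl
  length-visits I M (b ∷ w) = cong suc (length-visits I (fire S M b) w)

  visits-AgreeOn : ∀ {I M M′} w → AgreeOn I M M′ → visits I M w ≡ visits I M′ w
  visits-AgreeOn []      e = refl
  visits-AgreeOn (b ∷ w) e = cong₂ _∷_ (AgreeOn⇒projection≡ e) (visits-AgreeOn w (fire-AgreeOn b e))

  record AcyclicRun (I : List (Place S)) (R : Marking S → Trans S → Set) (M T : Marking S) : Set where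
    constructor acyclicRun
    field
      path    : List (Trans S)
      run     : Run R M path
      reaches : AgreeOn I (after S M path) T
      acyclic : Unique (visits I M path)

  AcyclicRun-AgreeOn : ∀ {I R M M′ T} → RespectsAgreeOn I R → AgreeOn I M M′ →
                       AcyclicRun I R M T → AcyclicRun I R M′ T
  AcyclicRun-AgreeOn resp e (acyclicRun w rs t u) =
    acyclicRun w (Run-AgreeOn resp w e rs)
               (AgreeOn-trans (after-AgreeOn w (AgreeOn-sym e)) t)
               (subst Unique (visits-AgreeOn w e) u)

  suffixFrom : ∀ {I R x T} M w → x ∈ visits I M w → Run R M w → Unique (visits I M w) →
               AgreeOn I (after S M w) T → ∃ λ M′ → x ≡ projection I M′ × AcyclicRun I R M′ T
  suffixFrom M (b ∷ w) (here x≡) rs       u       t = M , x≡ , acyclicRun (b ∷ w) rs t u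
  suffixFrom M (b ∷ w) (there x∈) (_ , rs) (_ ∷ u) t = suffixFrom (fire S M b) w x∈ rs u t

  removeCycles : ∀ {I R} → RespectsAgreeOn I R → ∀ M w → Run R M w → AcyclicRun I R M (after S M w)
  removeCycles {I} resp M []      _        = acyclicRun [] tt (AgreeOn-refl I M) []
  removeCycles {I} resp M (b ∷ w) (r , rs) with removeCycles resp (fire S M b) w rs
  ... | acyclicRun w′ rs′ t′ u′ with Any.any? (≡-dec ℕ._≟_ (projection I M)) (visits I (fire S M b) w′)
  ...   | no new   = acyclicRun (b ∷ w′) (r , rs′) t′ (¬Any⇒All¬ _ new ∷ u′)
  ...   | yes seen with suffixFrom (fire S M b) w′ seen rs′ u′ t′
  ...     | M′ , same , ρ = AcyclicRun-AgreeOn resp (projection≡⇒AgreeOn I (sym same)) ρ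

  AcyclicRun-length : ∀ {I R M T} (E : List (List ℕ)) → (∀ {M b} → R M b → projection I M ∈ E) →
                      (ρ : AcyclicRun I R M T) → length (AcyclicRun.path ρ) ≤ length E
  AcyclicRun-length {I} {R} E inE (acyclicRun w rs _ u) =
    subst (_≤ length E) (length-visits I _ w) (Unique-⊆⇒length≤ (≡-dec ℕ._≟_) u (visits⊆E w rs))
    where
      visits⊆E : ∀ {M} w → Run R M w → visits I M w ⊆ E
      visits⊆E (b ∷ w) (r , _)  (here refl) = inE r
      visits⊆E (b ∷ w) (_ , rs) (there z∈)  = visits⊆E w rs z∈

  Bounded : ℕ → List (Place S) → Marking S → Set
  Bounded B I M = All (λ p → M p < B) I

  Exceeds : ℕ → List (Place S) → Marking S → Set
  Exceeds B I M = Any (λ p → B ≤ M p) I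

  ¬Exceeds⇒Bounded : ∀ {B I M} → ¬ Exceeds B I M → Bounded B I M
  ¬Exceeds⇒Bounded {I = I} ¬ex = All.map ≰⇒> (¬Any⇒All¬ I ¬ex)

  projection∈listsUpTo : ∀ {B I M m} → length I ≤ m → Bounded B I M → projection I M ∈ listsUpTo (upTo B) m
  projection∈listsUpTo {B} {I} {M} {m} |I|≤m bounded =
    ∈-listsUpTo (upTo B) m (map⁺ (All.map ∈-upTo⁺ bounded)) (subst (_≤ m) (sym (length-map M I)) |I|≤m)

  shortenBounded : ∀ {B I m} M u → length I ≤ m →
                   Run (λ M′ b → EnabledOn I M′ b × ¬ Exceeds B I M′) M u →
                   ∃ λ u′ → length u′ ≤ length (listsUpTo (upTo B) m)
                            × Run (EnabledOn I) M u′ × AgreeOn I (after S M u′) (after S M u)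
  shortenBounded {B} {I} {m} M u |I|≤m rs = path , length≤ , Run-map proj₁ path run , reaches
    where
      respects : RespectsAgreeOn I (λ M′ b → EnabledOn I M′ b × Bounded B I M′)
      respects e (en , bd) = EnabledOn-respects e en , AgreeOn-subst (λ _ n → n < B) e bd
      ρ : AcyclicRun I (λ M′ b → EnabledOn I M′ b × Bounded B I M′) M (after S M u)
      ρ = removeCycles respects M u (Run-map (λ (en , ¬ex) → en , ¬Exceeds⇒Bounded ¬ex) u rs)
      open AcyclicRun ρ
      length≤ : length path ≤ length (listsUpTo (upTo B) m)
      length≤ = AcyclicRun-length _ (λ (_ , bd) → projection∈listsUpTo |I|≤m bd) ρ

  pre≤1 : ∀ b p → pre S b p ≤ 1
  pre≤1 b p with Fpt p b
  ... | true  = ≤-refl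
  ... | false = z≤n

  ≤-suc-fire : ∀ M b p → M p ≤ suc (fire S M b p)
  ≤-suc-fire M b p = begin
    M p                           ≤⟨ m≤n+m∸n (M p) (pre S b p) ⟩
    pre S b p + (M p ∸ pre S b p) ≤⟨ +-monoˡ-≤ _ (pre≤1 b p) ⟩
    suc (M p ∸ pre S b p)         ≤⟨ s≤s (m≤m+n _ _) ⟩
    suc (fire S M b p)            ∎
    where open ≤-Reasoning

  EnabledOn-─⁻ : ∀ {Q : Place S → Set} {I M b} (i : Any Q I) → 0 < M (Any.lookup i) →
                 EnabledOn (I ─ i) M b → EnabledOn I M b
  EnabledOn-─⁻ {b = b} i marked = ─⁻ i (≤-trans (pre≤1 b _) marked)

  FirableThenOn-─⁺ : ∀ {Q : Place S → Set} {I M a} (i : Any Q I) w →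
                     FirableThenOn I M w a → FirableThenOn (I ─ i) M w a
  FirableThenOn-─⁺ i w (rs , en) = Run-map (─⁺ i) w rs , ─⁺ i en

  FirableThenOn-─⁻ : ∀ {Q : Place S → Set} {I a} (i : Any Q I) M w → length w < M (Any.lookup i) →
                     FirableThenOn (I ─ i) M w a → FirableThenOn I M w a
  FirableThenOn-─⁻ i M []      tokens (_ , en)        = tt , EnabledOn-─⁻ i tokens en
  FirableThenOn-─⁻ i M (b ∷ w) tokens ((e , rs) , en) =
    let rs′ , en′ = FirableThenOn-─⁻ i (fire S M b) w tokens′ (rs , en)
    in (EnabledOn-─⁻ i (≤-trans (s≤s z≤n) tokens) e , rs′) , en′
    where
      tokens′ : length w < fire S M b (Any.lookup i)
      tokens′ = ≤-pred (≤-trans tokens (≤-suc-fire M b (Any.lookup i)))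

  ShortWitnesses : Trans S → ℕ → ℕ → Set
  ShortWitnesses a n K = ∀ I → length I ≤ n → ∀ M w → FirableThenOn I M w a →
                         ∃ λ w′ → length w′ ≤ K × FirableThenOn I M w′ a

  Exceeds-AgreeOn : ∀ {B I M M′} → AgreeOn I M M′ → Exceeds B I M → Exceeds B I M′
  Exceeds-AgreeOn (e ∷ _)  (here ex)  = here (subst (_ ≤_) e ex)
  Exceeds-AgreeOn (_ ∷ es) (there ex) = there (Exceeds-AgreeOn es ex)

  dropExceeding : ∀ {a n K I M w} → ShortWitnesses a n K → length I ≤ suc n →
                  (ex : Exceeds (suc K) I M) → FirableThenOn I M w a →
                  ∃ λ w′ → length w′ ≤ K × FirableThenOn I M w′ a
  dropExceeding {n = n} {I = I} {M} {w} short |I|≤ ex fw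
    with short (I ─ ex) |I─ex|≤ M w (FirableThenOn-─⁺ ex w fw)
    where
      |I─ex|≤ : length (I ─ ex) ≤ n
      |I─ex|≤ = ≤-pred (subst (_≤ _) (length-removeAt′ I (Any.index ex)) |I|≤)
  ... | w′ , |w′|≤K , fw′ =
    w′ , |w′|≤K , FirableThenOn-─⁻ ex M w′ (≤-trans (s≤s |w′|≤K) (lookup-result ex)) fw′

  shortWitnesses-zero : ∀ a → ShortWitnesses a 0 0
  shortWitnesses-zero a [] _ M w _ = [] , z≤n , tt , []

  shortWitnesses-suc : ∀ {a n K} → ShortWitnesses a n K →
                       ShortWitnesses a (suc n) (length (listsUpTo (upTo (suc K)) (suc n)) + K)
  shortWitnesses-suc {a} {n} {K} short I |I|≤ M w (rs , en)
    with firstHit (λ M′ → Any.any? (λ p → suc K ≤? M′ p) I) M w rs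
  ... | inj₁ bounded =
    let w′ , |w′|≤ , rs′ , agree = shortenBounded M w |I|≤ bounded
    in w′ , ≤-trans |w′|≤ (m≤m+n _ K) , rs′ , EnabledOn-respects (AgreeOn-sym agree) en
  ... | inj₂ (u , v , refl , boundedᵤ , ex , rsᵥ)
    with shortenBounded M u |I|≤ boundedᵤ
  ... | u′ , |u′|≤ , rsᵤ′ , agree
    with dropExceeding short |I|≤ (Exceeds-AgreeOn (AgreeOn-sym agree) ex)
           (FirableThenOn-AgreeOn v (AgreeOn-sym agree)
              (rsᵥ , subst (λ M′ → EnabledOn I M′ a) (after-++ M u v) en))
  ... | v′ , |v′|≤K , fv′ =
    u′ ++ v′ , subst (_≤ _) (sym (length-++ u′)) (+-mono-≤ |u′|≤ |v′|≤K) , FirableThenOn-++ M u′ rsᵤ′ fv′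

  shortWitnesses : ∀ a n → ∃ (ShortWitnesses a n)
  shortWitnesses a zero    = 0 , shortWitnesses-zero a
  shortWitnesses a (suc n) = _ , shortWitnesses-suc (proj₂ (shortWitnesses a n))

  Enabled⇒EnabledOn : ∀ {I M b} → Enabled S M b → EnabledOn I M b
  Enabled⇒EnabledOn en = All.tabulate (λ {p} _ → en p)

  EnabledOn-allFin⇒Enabled : ∀ {M b} → EnabledOn (allFin np) M b → Enabled S M b
  EnabledOn-allFin⇒Enabled en p = All.lookup en (∈-allFin p)

  FirableThen⇒FirableThenOn : ∀ {I M a} w → FirableThen S M w a → FirableThenOn I M w a
  FirableThen⇒FirableThenOn []      (_ , en)        = tt , Enabled⇒EnabledOn en
  FirableThen⇒FirableThenOn (b ∷ w) ((e , fs) , en) =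
    let rs , en′ = FirableThen⇒FirableThenOn w (fs , en) in (Enabled⇒EnabledOn e , rs) , en′

  FirableThenOn-allFin⇒FirableThen : ∀ {M a} w → FirableThenOn (allFin np) M w a → FirableThen S M w a
  FirableThenOn-allFin⇒FirableThen []      (_ , en)        = tt , EnabledOn-allFin⇒Enabled en
  FirableThenOn-allFin⇒FirableThen (b ∷ w) ((e , rs) , en) =
    let fs , en′ = FirableThenOn-allFin⇒FirableThen w (rs , en) in (EnabledOn-allFin⇒Enabled e , fs) , en′

  live⇒kEnabled : ∀ a → ∃ λ k → ∀ M → Live S M a → KEnabled S k M a
  live⇒kEnabled a = K , λ M (w , fw) →
    let w′ , |w′|≤K , fw′ = short (allFin np) |allFin|≤np M w (FirableThen⇒FirableThenOn w fw)
    in w′ , |w′|≤K , FirableThenOn-allFin⇒FirableThen w′ fw′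
    where
      K : ℕ
      K = proj₁ (shortWitnesses a np)
      short : ShortWitnesses a np K
      short = proj₂ (shortWitnesses a np)
      |allFin|≤np : length (allFin np) ≤ np
      |allFin|≤np = ≤-reflexive (length-tabulate (λ p → p))

  enabled? : ∀ M b → Dec (Enabled S M b)
  enabled? M b = all? (λ p → pre S b p ≤? M p)

  firable? : ∀ M w → Dec (Firable S M w)
  firable? M []      = yes tt
  firable? M (b ∷ w) = enabled? M b ×-dec firable? (fire S M b) w

  kEnabled? : ∀ k M a → Dec (KEnabled S k M a)
  kEnabled? k M a
    with Any.any? (λ w → length w ≤? k ×-dec (firable? M w ×-dec enabled? (after S M w) a))
                  (listsUpTo (allFin nt) k)
  ... | yes found = yes (Any.satisfied found)
  ... | no none   = no λ (w , |w|≤k , fw) →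
    none (Any.map (λ { refl → |w|≤k , fw })
                  (∈-listsUpTo (allFin nt) k (All.tabulate (λ {b} _ → ∈-allFin b)) |w|≤k))

lemma2 : (S : PTNet) → (a : Trans S) →
    ∃ λ (k : ℕ) → (M : Marking S) → KEnabled S k M a ⊎ Dead S M a
lemma2 S a = k , kEnabledOrDead
  where
    k : ℕ
    k = proj₁ (live⇒kEnabled S a)
    kEnabledOrDead : (M : Marking S) → KEnabled S k M a ⊎ Dead S M a
    kEnabledOrDead M with kEnabled? S k M a
    ... | yes enabled   = inj₁ enabled
    ... | no notEnabled = inj₂ (notEnabled ∘ proj₂ (live⇒kEnabled S a) M)
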